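{- Let $n \geq 6$ be an integer with $n \equiv 1 \pmod 3$, and let $T$ be a tree on $n$ vertices not isomorphic to $K_{1, n-1}$. If $T$ has a vertex of degree $\equiv 0 \pmod 3$, then for every restrictive edge-colouring $f$ of $K_n$ with colours in $\mathbb{Z}_3$ there is a copy of $T$ in $K_n$ whose edge colours sum to $0$ in $\mathbb{Z}_3$. If $T$ has no vertex of degree $\equiv 0 \pmod 3$, then for every restrictive edge-colouring of $K_{n+1}$ with colours in $\mathbb{Z}_3$ there is a copy of $T$ in $K_{n+1}$ whose edge colours sum to $0$ in $\mathbb{Z}_3$.
   Context: An edge-colouring of $K_m$ is restrictive if every vertex has at least $m-2$ of its $m-1$ incident edges coloured the same colour. A copy of $T$ in $K_m$ is a subgraph isomorphic to $T$. -}

module Defs where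

open import Data.Nat using (ℕ; zero; suc; _+_; _≤_; _<ᵇ_)
open import Data.Nat.DivMod using (_%_)
open import Data.Bool using (Bool; true; false; if_then_else_; _xor_; not)
open import Data.Fin using (Fin; toℕ)
open import Data.Fin.Properties using (_≟_)
open import Data.List using (List; map; allFin)
open import Data.Nat.ListAction using (sum)
open import Data.Product using (Σ; ∃; _×_; _,_)
open import Relation.Binary.PropositionalEquality using (_≡_)
open import Relation.Binary.Construct.Closure.ReflexiveTransitive using (Star)
open import Relation.Nullary using (¬_)
open import Relation.Nullary.Decidable using (⌊_⌋)
open import Function.Bundles using (_↔_; Inverse)
open import Function.Definitions using (Injective)

Σfin : (n : ℕ) → (Fin n → ℕ) → ℕ
Σfin n g = sum (map g (allFin n))

countFin : (n : ℕ) → (Fin n → Bool) → ℕ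
countFin n p = Σfin n (λ i → if p i then 1 else 0)

record Graph (n : ℕ) : Set where
  field
    adj   : Fin n → Fin n → Bool
    sym   : ∀ i j → adj i j ≡ adj j i
    loopless : ∀ i → adj i i ≡ false
open Graph public

edgeCount : ∀ {n} → Graph n → ℕ
edgeCount {n} G = Σfin n (λ i → countFin n (λ j → (toℕ i <ᵇ toℕ j) Data.Bool.∧ adj G i j))
  where import Data.Bool

Connected : ∀ {n} → Graph n → Set
Connected {n} G = ∀ (i j : Fin n) → Star (λ u v → adj G u v ≡ true) i j

IsTree : ∀ {n} → Graph n → Set
IsTree {n} G = Connected G × (suc (edgeCount G) ≡ n)

degree : ∀ {n} → Graph n → Fin n → ℕ
degree {n} G i = countFin n (adj G i)

Isomorphic : ∀ {n} → Graph n → Graph n → Set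
Isomorphic {n} G H =
  Σ (Fin n ↔ Fin n) λ e → ∀ i j → adj H (Inverse.to e i) (Inverse.to e j) ≡ adj G i j

isZero : ∀ {n} → Fin n → Bool
isZero i with toℕ i
... | zero = true
... | suc _ = false

Star-graph : (n : ℕ) → Graph n
Star-graph n = record
  { adj = λ i j → isZero i xor isZero j
  ; sym = λ i j → xor-comm (isZero i) (isZero j)
  ; loopless = λ i → xor-same (isZero i) }
  where
  open import Relation.Binary.PropositionalEquality using (refl)
  xor-comm : ∀ a b → (a xor b) ≡ (b xor a)
  xor-comm false false = refl
  xor-comm false true = refl
  xor-comm true false = refl
  xor-comm true true = refl
  xor-same : ∀ a → (a xor a) ≡ false
  xor-same false = refl
  xor-same true = refl

-- An edge-colouring of K_m with colours in ℤ₃ = Fin 3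
-- (colour of edge {u,v} is c u v; the diagonal is irrelevant).
record Colouring (m : ℕ) : Set where
  field
    col    : Fin m → Fin m → Fin 3
    colSym : ∀ u v → col u v ≡ col v u
open Colouring public

-- Restrictive: every vertex v has some colour c on at least m-2 of its m-1 incident edges.
Restrictive : ∀ {m} → Colouring m → Set
Restrictive {m} f =
  ∀ (v : Fin m) → ∃ λ (c : Fin 3) →
    m ≤ 2 + countFin m (λ w → not ⌊ v ≟ w ⌋ Data.Bool.∧ ⌊ col f v w ≟ c ⌋)
  where import Data.Bool

-- A copy of T in K_m: an injective vertex map Fin n → Fin m (its image edges).
-- Sum of the colours of the copy's edges (as natural numbers; zero in ℤ₃ iff ≡ 0 mod 3).
copyColourSum : ∀ {n m} → Graph n → Colouring m → (Fin n → Fin m) → ℕ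
copyColourSum {n} T f φ =
  Σfin n (λ i → Σfin n (λ j →
    if (toℕ i <ᵇ toℕ j) Data.Bool.∧ adj T i j then toℕ (col f (φ i) (φ j)) else 0))
  where import Data.Bool

ZeroSumCopy : ∀ {n m} → Graph n → Colouring m → Set
ZeroSumCopy {n} {m} T f =
  ∃ λ (φ : Fin n → Fin m) → Injective _≡_ _≡_ φ × (copyColourSum T f φ % 3 ≡ 0)

HasDegree0mod3 : ∀ {n} → Graph n → Set
HasDegree0mod3 {n} T = ∃ λ (v : Fin n) → degree T v % 3 ≡ 0

-- On K_m with m ≥ 7 a restrictive colouring gives every vertex v a dominant colour d(v) and at most one
-- exceptional neighbour. Two disjoint pairs of vertices with different dominant colours would force any
-- vertex outside them to be exceptional towards both pairs, so d is constant, say c, off a single vertex D.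
-- If d(D) = c as well, the edges not coloured c form a matching. Listing T colour class by colour class
-- (so that, T not being a star, consecutive vertices are never adjacent) and K_m so that matched vertices
-- are consecutive, and pairing the two lists, embeds T with every edge coloured c. Otherwise every edge
-- avoiding D has colour c and every edge at D but one has colour d(D): in K_(n+1) embed T avoiding D; in
-- K_n put a vertex t of degree ≡ 0 (mod 3) on D and a non-neighbour of t on D's exceptional neighbour.
-- The colour sum is then c(n - 1) or c(n - 1 - deg t) + d(D) deg t, divisible by 3 as 3 ∣ n - 1.

module Submission where

open import Defs renaming (sym to adj-sym)
open import Data.Nat
  using (ℕ; zero; suc; _+_; _*_; _≤_; _<_; _<ᵇ_; z≤n; s≤s; z<s; _<?_; _≤?_; _≟_; parity; ⌊_/2⌋)
open import Data.Nat.Properties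
open import Data.Nat.DivMod using (_%_; _/_; m≡m%n+[m/n]*n)
open import Data.Nat.Divisibility
  using (_∣_; divides; ∣n⇒∣m*n; ∣m+n∣m⇒∣n; ∣m∣n⇒∣m+n; n∣m⇒m%n≡0; m%n≡0⇒n∣m)
open import Data.Bool using (Bool; true; false; _∧_; not; if_then_else_; _xor_)
open import Data.Bool.Properties using (∧-zeroʳ; ∧-identityʳ; ¬-not; not-¬) renaming (_≟_ to _≟ᵇ_)
open import Data.Parity.Base using (Parity; 0ℙ; 1ℙ; _⁻¹)
open import Data.Parity.Properties
  using (suc-homo-⁻¹; ⁻¹-involutive; p≢p⁻¹; +-homo-+; p+p≡0ℙ) renaming (_≟_ to _≟ᵖ_)
open import Data.Fin.Permutation using (Permutation; _⟨$⟩ʳ_; _∘ₚ_; transpose)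
open import Function.Bundles using (Injection; mk⇔)
open import Function.Properties.Inverse using (↔⇒↣)
open import Data.Fin using (Fin; zero; suc; toℕ; fromℕ<; punchOut; punchIn)
open import Data.Fin.Properties
  using (any?; toℕ-injective; toℕ-fromℕ<; toℕ<n; injective⇒≤; punchOut-injective; punchIn-injective; punchInᵢ≢i)
  renaming (_≟_ to _≟ᶠ_)
open import Data.List using (List; []; _∷_; length)
open import Data.List.Membership.Propositional using (_∈_; _∉_)
import Data.List.Membership.DecPropositional as DecMembership
open import Data.List.Relation.Unary.Any using (index; here; there)
open import Data.List.Relation.Unary.Any.Properties using (lookup-index)
open import Data.List.Properties using (map-tabulate)
open import Data.Product using (_×_; _,_; ∃; ∃₂; proj₁; proj₂)
open import Data.Sum using (_⊎_; inj₁; inj₂; [_,_]′; swap)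
open import Data.Empty using (⊥; ⊥-elim)
open import Function using (_∘_)
open import Function.Definitions using (Injective)
open import Relation.Binary.PropositionalEquality
open import Relation.Nullary using (¬_; Dec; yes; no; ¬?; does; _×-dec_; _⊎-dec_)
open import Relation.Nullary.Decidable
  using (⌊_⌋; isYes≗does; dec-true; dec-false; does-⇔; decidable-stable)
open import Relation.Binary.Definitions using (tri<; tri≈; tri>; DecidableEquality)
open import Relation.Binary.Construct.Closure.ReflexiveTransitive using (Star; ε; _◅_)
open import Algebra.Properties.Semiring.Sum +-*-semiring
  using (sum; sum-cong-≗; ∑-distrib-+; ∑-comm; *-distribˡ-sum)
import Data.List as List
import Data.Nat.ListAction as ℕ-List

-- Arithmetic

𝟙 : Bool → ℕ
𝟙 b = if b then 1 else 0

𝟙≤1 : ∀ b → 𝟙 b ≤ 1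
𝟙≤1 true  = ≤-refl
𝟙≤1 false = z≤n

<ᵇ-true : ∀ {x y} → x < y → (x <ᵇ y) ≡ true
<ᵇ-true {x} {y} = dec-true (x <? y)

<ᵇ-false : ∀ {x y} → ¬ x < y → (x <ᵇ y) ≡ false
<ᵇ-false {x} {y} = dec-false (x <? y)

𝟙-<ᵇ-yes : ∀ {x y} → x < y → 𝟙 (x <ᵇ y) ≡ 1
𝟙-<ᵇ-yes = cong 𝟙 ∘ <ᵇ-true

𝟙-<ᵇ-no : ∀ {x y} → ¬ x < y → 𝟙 (x <ᵇ y) ≡ 0
𝟙-<ᵇ-no = cong 𝟙 ∘ <ᵇ-false

parity-suc : ∀ k → parity (suc k) ≡ parity k ⁻¹
parity-suc k = trans (sym (⁻¹-involutive (parity (suc k)))) (cong _⁻¹ (suc-homo-⁻¹ k))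

parity-double : ∀ x → parity (x + x) ≡ 0ℙ
parity-double x = trans (+-homo-+ x x) (p+p≡0ℙ (parity x))

double-injective : ∀ {x y} → x + x ≡ y + y → x ≡ y
double-injective {x} {y} eq = trans (n≡⌊n+n/2⌋ x) (trans (cong ⌊_/2⌋ eq) (sym (n≡⌊n+n/2⌋ y)))

odd≢double : ∀ x y → suc (x + x) ≢ y + y
odd≢double x y eq = p≢p⁻¹ 0ℙ (trans (sym (parity-double y)) (trans (cong parity (sym eq))
                                (trans (parity-suc (x + x)) (cong _⁻¹ (parity-double x)))))

least-witness : ∀ {P : ℕ → Set} → (∀ k → Dec (P k)) → ∀ {k} → P k →
                ∃ λ ℓ → P ℓ × (∀ {j} → j < ℓ → ¬ P j)
least-witness P? {zero}  p0 = 0 , p0 , λ ()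
least-witness P? {suc k} pk with P? 0
... | yes p0 = 0 , p0 , λ ()
... | no ¬p0 with least-witness (P? ∘ suc) pk
...   | ℓ , pℓ , below = suc ℓ , pℓ , λ { {zero} _ → ¬p0 ; {suc j} j<ℓ → below (≤-pred j<ℓ) }

-- Finite sums

Σfin≡sum : ∀ n (g : Fin n → ℕ) → Σfin n g ≡ sum g
Σfin≡sum n g = trans (cong ℕ-List.sum (map-tabulate (λ i → i) g)) (tabulate-sum n g)
  where
  tabulate-sum : ∀ n (g : Fin n → ℕ) → ℕ-List.sum (List.tabulate g) ≡ sum g
  tabulate-sum zero    g = refl
  tabulate-sum (suc n) g = cong (g zero +_) (tabulate-sum n (g ∘ suc))

sum-const : ∀ n c → sum {n} (λ _ → c) ≡ n * c
sum-const zero    c = refl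
sum-const (suc n) c = cong (c +_) (sum-const n c)

sum-mono-≤ : ∀ {n} {f g : Fin n → ℕ} → (∀ i → f i ≤ g i) → sum f ≤ sum g
sum-mono-≤ {zero}  f≤g = z≤n
sum-mono-≤ {suc n} f≤g = +-mono-≤ (f≤g zero) (sum-mono-≤ (f≤g ∘ suc))

sum-mono-< : ∀ {n} {f g : Fin n → ℕ} → (∀ i → f i ≤ g i) → ∀ k → f k < g k → sum f < sum g
sum-mono-< {suc n} f≤g zero    fk<gk = +-mono-<-≤ fk<gk (sum-mono-≤ (f≤g ∘ suc))
sum-mono-< {suc n} f≤g (suc k) fk<gk = +-mono-≤-< (f≤g zero) (sum-mono-< (f≤g ∘ suc) k fk<gk)

sum-≡⇒≗ : ∀ {n} {f g : Fin n → ℕ} → (∀ i → f i ≤ g i) → sum f ≡ sum g → ∀ i → f i ≡ g i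
sum-≡⇒≗ {f = f} {g} f≤g sum≡ i with <-cmp (f i) (g i)
... | tri< fi<gi _ _ = ⊥-elim (<-irrefl sum≡ (sum-mono-< f≤g i fi<gi))
... | tri≈ _ fi≡gi _ = fi≡gi
... | tri> _ _ fi>gi = ⊥-elim (<⇒≱ fi>gi (f≤g i))

sum-single : ∀ {n} {f : Fin n → ℕ} a → (∀ j → j ≢ a → f j ≡ 0) → sum f ≡ f a
sum-single {suc n} {f} zero    f≡0 =
  trans (cong (f zero +_) (trans (sum-cong-≗ {y = λ _ → 0} (λ j → f≡0 (suc j) λ ()))
                                (trans (sum-const n 0) (*-zeroʳ n))))
        (+-identityʳ _)
sum-single {suc n} {f} (suc a) f≡0 =
  trans (cong (_+ sum (f ∘ suc)) (f≡0 zero λ ()))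
        (sum-single a (λ j j≢a → f≡0 (suc j) (j≢a ∘ Data.Fin.Properties.suc-injective)))

sum-𝟙-≡ : ∀ {n} a → sum {n} (λ x → 𝟙 (does (x ≟ᶠ a))) ≡ 1
sum-𝟙-≡ a = trans (sum-single a (λ j j≢a → cong 𝟙 (dec-false (j ≟ᶠ a) j≢a)))
                  (cong 𝟙 (dec-true (a ≟ᶠ a) refl))

countFin-three-misses : ∀ {m} (p : Fin m → Bool) {a b c} → a ≢ b → a ≢ c → b ≢ c →
                        p a ≡ false → p b ≡ false → p c ≡ false → countFin m p + 3 ≤ m
countFin-three-misses {m} p {a} {b} {c} a≢b a≢c b≢c pa pb pc = begin
    countFin m p + 3
      ≡⟨ cong₂ _+_ (Σfin≡sum m _) (sym (cong₂ _+_ (sum-𝟙-≡ a) (cong₂ _+_ (sum-𝟙-≡ b) (sum-𝟙-≡ c)))) ⟩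
    sum P + (sum (δ a) + (sum (δ b) + sum (δ c)))
      ≡⟨ sym (trans (∑-distrib-+ P _) (cong (sum P +_)
               (trans (∑-distrib-+ (δ a) _) (cong (sum (δ a) +_) (∑-distrib-+ (δ b) (δ c)))))) ⟩
    sum (λ x → P x + (δ a x + (δ b x + δ c x)))
      ≤⟨ sum-mono-≤ at-most-one ⟩
    sum {m} (λ _ → 1)
      ≡⟨ trans (sum-const m 1) (*-identityʳ m) ⟩
    m ∎
  where
  open ≤-Reasoning
  P : Fin m → ℕ
  P x = 𝟙 (p x)
  δ : Fin m → Fin m → ℕ
  δ y x = 𝟙 (does (x ≟ᶠ y))
  at-most-one : ∀ x → P x + (δ a x + (δ b x + δ c x)) ≤ 1
  at-most-one x with x ≟ᶠ a | x ≟ᶠ b | x ≟ᶠ c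
  ... | yes refl | yes x≡b  | _        = ⊥-elim (a≢b x≡b)
  ... | yes refl | no _     | yes x≡c  = ⊥-elim (a≢c x≡c)
  ... | yes refl | no _     | no _     rewrite pa = ≤-refl
  ... | no _     | yes refl | yes x≡c  = ⊥-elim (b≢c x≡c)
  ... | no _     | yes refl | no _     rewrite pb = ≤-refl
  ... | no _     | no _     | yes refl rewrite pc = ≤-refl
  ... | no _     | no _     | no _     = ≤-trans (≤-reflexive (+-identityʳ _)) (𝟙≤1 (p x))

-- Finite sets and permutations

_∈?_ : ∀ {m} (z : Fin m) (xs : List (Fin m)) → Dec (z ∈ xs)
z ∈? xs = DecMembership._∈?_ _≟ᶠ_ z xs

∃-∉ : ∀ {m} (xs : List (Fin m)) → length xs < m → ∃ (_∉ xs)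
∃-∉ {m} xs len<m with any? (λ z → ¬? (z ∈? xs))
... | yes z∉xs = z∉xs
... | no ¬z∉xs = ⊥-elim (<⇒≱ len<m (injective⇒≤ {f = position} position-injective))
  where
  member : ∀ z → z ∈ xs
  member z = decidable-stable (z ∈? xs) (λ z∉xs → ¬z∉xs (z , z∉xs))
  position : Fin m → Fin (length xs)
  position z = index (member z)
  position-injective : Injective _≡_ _≡_ position
  position-injective {x} {y} eq =
    trans (lookup-index (member x)) (trans (cong (List.lookup xs) eq) (sym (lookup-index (member y))))

injective⇒surjective : ∀ {N} {f : Fin N → Fin N} → Injective _≡_ _≡_ f → ∀ y → ∃ λ x → f x ≡ y
injective⇒surjective {suc N} {f} f-inj y with any? (λ x → f x ≟ᶠ y)
... | yes hit = hit
... | no miss = ⊥-elim (1+n≰n (injective⇒≤ {f = g} λ eq → f-inj (punchOut-injective (y≢f _) (y≢f _) eq)))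
  where
  y≢f : ∀ x → y ≢ f x
  y≢f x y≡fx = miss (x , sym y≡fx)
  g : Fin (suc N) → Fin N
  g x = punchOut (y≢f x)

permutation-injective : ∀ {n} (π : Permutation n n) → Injective _≡_ _≡_ (π ⟨$⟩ʳ_)
permutation-injective π = Injection.injective (↔⇒↣ π)

transpose-applyˡ : ∀ {n} (i j : Fin n) → transpose i j ⟨$⟩ʳ i ≡ j
transpose-applyˡ i j rewrite dec-true (i ≟ᶠ i) refl = refl

transpose-fix : ∀ {n} {i j k : Fin n} → k ≢ i → k ≢ j → transpose i j ⟨$⟩ʳ k ≡ k
transpose-fix {i = i} {j} {k} k≢i k≢j rewrite dec-false (k ≟ᶠ i) k≢i | dec-false (k ≟ᶠ j) k≢j = refl

∃-permutation-sending : ∀ {n} {s t x y : Fin n} → s ≢ t → y ≢ x →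
                        ∃ λ (π : Permutation n n) → π ⟨$⟩ʳ t ≡ x × π ⟨$⟩ʳ s ≡ y
∃-permutation-sending {s = s} {t} {x} {y} s≢t y≢x =
  transpose t x ∘ₚ transpose s′ y ,
  trans (cong (transpose s′ y ⟨$⟩ʳ_) (transpose-applyˡ t x)) (transpose-fix x≢s′ (y≢x ∘ sym)) ,
  transpose-applyˡ s′ y
  where
  s′ = transpose t x ⟨$⟩ʳ s
  x≢s′ : x ≢ s′
  x≢s′ x≡s′ = s≢t (permutation-injective (transpose t x)
                     (trans (sym x≡s′) (sym (transpose-applyˡ t x))))

-- The linear order induced by an injective key

rank : ∀ {N} → (Fin N → ℕ) → Fin N → ℕ
rank key v = sum (λ w → 𝟙 (key w <ᵇ key v))

module _ {N} (key : Fin N → ℕ) where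

  rank-mono-< : ∀ {v w} → key v < key w → rank key v < rank key w
  rank-mono-< {v} {w} kv<kw = sum-mono-< below-v⇒below-w v (begin-strict
      𝟙 (key v <ᵇ key v) ≡⟨ 𝟙-<ᵇ-no {key v} (<-irrefl refl) ⟩
      0                  <⟨ z<s ⟩
      1                  ≡⟨ 𝟙-<ᵇ-yes kv<kw ⟨
      𝟙 (key v <ᵇ key w) ∎)
    where
    open ≤-Reasoning
    below-v⇒below-w : ∀ x → 𝟙 (key x <ᵇ key v) ≤ 𝟙 (key x <ᵇ key w)
    below-v⇒below-w x with key x <? key v
    ... | yes kx<kv = ≤-reflexive (trans (𝟙-<ᵇ-yes kx<kv) (sym (𝟙-<ᵇ-yes (<-trans kx<kv kv<kw))))
    ... | no  kx≮kv = ≤-trans (≤-reflexive (𝟙-<ᵇ-no kx≮kv)) z≤n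

  rank<N : ∀ v → rank key v < N
  rank<N v = begin-strict
      rank key v            <⟨ sum-mono-< (λ x → 𝟙≤1 (key x <ᵇ key v)) v
                                 (≤-<-trans (≤-reflexive (𝟙-<ᵇ-no {key v} (<-irrefl refl))) z<s) ⟩
      sum {N} (λ _ → 1)     ≡⟨ trans (sum-const N 1) (*-identityʳ N) ⟩
      N                     ∎
    where open ≤-Reasoning

  rank-consecutive-no-between : ∀ {u v w} → rank key w ≡ suc (rank key v) →
                                key v < key u → key u < key w → ⊥
  rank-consecutive-no-between {u} {v} {w} consecutive kv<ku ku<kw =
    <-irrefl (sym consecutive) (≤-<-trans (rank-mono-< kv<ku) (rank-mono-< ku<kw))

  module _ (key-injective : Injective _≡_ _≡_ key) where

    rank-injective : Injective _≡_ _≡_ (rank key)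
    rank-injective {v} {w} eq with <-cmp (key v) (key w)
    ... | tri< kv<kw _ _ = ⊥-elim (<-irrefl eq (rank-mono-< kv<kw))
    ... | tri≈ _ kv≡kw _ = key-injective kv≡kw
    ... | tri> _ _ kv>kw = ⊥-elim (<-irrefl (sym eq) (rank-mono-< kv>kw))

    rank-consecutive⇒key< : ∀ {v w} → rank key w ≡ suc (rank key v) → key v < key w
    rank-consecutive⇒key< {v} {w} consecutive with <-cmp (key v) (key w)
    ... | tri< kv<kw _ _ = kv<kw
    ... | tri≈ _ kv≡kw _ =
      ⊥-elim (1+n≢n (trans (sym consecutive) (cong (rank key) (sym (key-injective kv≡kw)))))
    ... | tri> _ _ kv>kw = ⊥-elim (<-asym (rank-mono-< kv>kw) (≤-reflexive (sym consecutive)))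

    key-consecutive⇒rank-consecutive : ∀ {v w} → key w ≡ suc (key v) → rank key w ≡ suc (rank key v)
    key-consecutive⇒rank-consecutive {v} {w} kw≡1+kv =
      ≤-antisym rank-w≤ (rank-mono-< (≤-reflexive (sym kw≡1+kv)))
      where
      open ≤-Reasoning
      below-w : ∀ x → 𝟙 (key x <ᵇ key w) ≤ 𝟙 (key x <ᵇ key v) + 𝟙 (does (x ≟ᶠ v))
      below-w x with key x <? key v | x ≟ᶠ v
      ... | yes kx<kv | _     =
        ≤-trans (𝟙≤1 _) (≤-trans (m≤m+n 1 _) (≤-reflexive (cong (_+ _) (sym (𝟙-<ᵇ-yes kx<kv)))))
      ... | no _      | yes _ = ≤-trans (𝟙≤1 _) (m≤n+m 1 _)
      ... | no kx≮kv  | no x≢v = ≤-trans (≤-reflexive (𝟙-<ᵇ-no λ kx<kw →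
              x≢v (key-injective (≤-antisym (≤-pred (subst (suc (key x) ≤_) kw≡1+kv kx<kw))
                                            (≮⇒≥ kx≮kv))))) z≤n
      rank-w≤ : rank key w ≤ suc (rank key v)
      rank-w≤ = begin
        rank key w
          ≤⟨ sum-mono-≤ below-w ⟩
        sum {N} (λ x → 𝟙 (key x <ᵇ key v) + 𝟙 (does (x ≟ᶠ v)))
          ≡⟨ ∑-distrib-+ (λ x → 𝟙 (key x <ᵇ key v)) _ ⟩
        rank key v + sum {N} (λ x → 𝟙 (does (x ≟ᶠ v)))
          ≡⟨ cong (rank key v +_) (sum-𝟙-≡ v) ⟩
        rank key v + 1
          ≡⟨ +-comm (rank key v) 1 ⟩
        suc (rank key v) ∎

    rank-surjective : ∀ k → k < N → ∃ λ v → rank key v ≡ k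
    rank-surjective k k<N =
      v , trans (sym (toℕ-fromℕ< (rank<N v))) (trans (cong toℕ position-v) (toℕ-fromℕ< k<N))
      where
      position : Fin N → Fin N
      position v = fromℕ< (rank<N v)
      position-injective : Injective _≡_ _≡_ position
      position-injective {v} {w} eq = rank-injective
        (trans (sym (toℕ-fromℕ< (rank<N v))) (trans (cong toℕ eq) (toℕ-fromℕ< (rank<N w))))
      hit = injective⇒surjective position-injective (fromℕ< k<N)
      v = proj₁ hit
      position-v = proj₂ hit

-- Graphs

adj⇒≢ : ∀ {n} (G : Graph n) {i j} → adj G i j ≡ true → i ≢ j
adj⇒≢ G {i} ij refl with trans (sym ij) (loopless G i)
... | ()

module _ {n} (G : Graph n) where

  onEdges : (Fin n → Fin n → ℕ) → Fin n → Fin n → ℕ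
  onEdges w i j = if (toℕ i <ᵇ toℕ j) ∧ adj G i j then w i j else 0

  edgeSum : (Fin n → Fin n → ℕ) → ℕ
  edgeSum w = sum (λ i → sum (onEdges w i))

  arcSum : (Fin n → Fin n → ℕ) → ℕ
  arcSum w = sum (λ i → sum (λ j → if adj G i j then w i j else 0))

  Σfin-edgeSum : ∀ w → Σfin n (λ i → Σfin n (onEdges w i)) ≡ edgeSum w
  Σfin-edgeSum w = trans (Σfin≡sum n (λ i → Σfin n (onEdges w i)))
                         (sum-cong-≗ (λ i → Σfin≡sum n (onEdges w i)))

  edgeSum-cong : ∀ {w w′} → (∀ i j → adj G i j ≡ true → w i j ≡ w′ i j) → edgeSum w ≡ edgeSum w′
  edgeSum-cong {w} {w′} w≡w′ = sum-cong-≗ λ i → sum-cong-≗ λ j → on-edges i j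
    where
    on-edges : ∀ i j → onEdges w i j ≡ onEdges w′ i j
    on-edges i j with toℕ i <ᵇ toℕ j | adj G i j in ij
    ... | true  | true  = w≡w′ i j ij
    ... | true  | false = refl
    ... | false | _     = refl

  edgeSum-distrib-+ : ∀ w w′ → edgeSum (λ i j → w i j + w′ i j) ≡ edgeSum w + edgeSum w′
  edgeSum-distrib-+ w w′ =
    trans (sum-cong-≗ λ i → trans (sum-cong-≗ (split i)) (∑-distrib-+ (onEdges w i) (onEdges w′ i)))
          (∑-distrib-+ (λ i → sum (onEdges w i)) (λ i → sum (onEdges w′ i)))
    where
    split : ∀ i j → onEdges (λ i j → w i j + w′ i j) i j ≡ onEdges w i j + onEdges w′ i j
    split i j with (toℕ i <ᵇ toℕ j) ∧ adj G i j
    ... | true  = refl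
    ... | false = refl

  edgeSum-* : ∀ c w → edgeSum (λ i j → c * w i j) ≡ c * edgeSum w
  edgeSum-* c w =
    trans (sum-cong-≗ λ i → trans (sum-cong-≗ (scale i)) (sym (*-distribˡ-sum c (onEdges w i))))
          (sym (*-distribˡ-sum c (λ i → sum (onEdges w i))))
    where
    scale : ∀ i j → onEdges (λ i j → c * w i j) i j ≡ c * onEdges w i j
    scale i j with (toℕ i <ᵇ toℕ j) ∧ adj G i j
    ... | true  = refl
    ... | false = sym (*-zeroʳ c)

  edgeSum+edgeSum-flip≡arcSum : ∀ w → edgeSum w + edgeSum (λ i j → w j i) ≡ arcSum w
  edgeSum+edgeSum-flip≡arcSum w = begin
      edgeSum w + edgeSum (λ i j → w j i)
        ≡⟨ cong (edgeSum w +_) (∑-comm (onEdges (λ i j → w j i))) ⟩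
      sum (λ i → sum (upper i)) + sum (λ i → sum (lower i))
        ≡⟨ sym (trans (sum-cong-≗ λ i → ∑-distrib-+ (upper i) (lower i))
                      (∑-distrib-+ (λ i → sum (upper i)) (λ i → sum (lower i)))) ⟩
      sum (λ i → sum (λ j → upper i j + lower i j))
        ≡⟨ sum-cong-≗ (λ i → sum-cong-≗ (upper+lower i)) ⟩
      arcSum w ∎
    where
    open ≡-Reasoning
    upper lower : Fin n → Fin n → ℕ
    upper = onEdges w
    lower i j = onEdges (λ i j → w j i) j i
    upper+lower : ∀ i j → upper i j + lower i j ≡ (if adj G i j then w i j else 0)
    upper+lower i j with <-cmp (toℕ i) (toℕ j)
    ... | tri< i<j _ j≮i rewrite <ᵇ-true i<j | <ᵇ-false j≮i = +-identityʳ _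
    ... | tri> i≮j _ j<i rewrite <ᵇ-false i≮j | <ᵇ-true j<i | adj-sym G j i = refl
    ... | tri≈ _ i≡j _ rewrite toℕ-injective i≡j | loopless G j | ∧-zeroʳ (toℕ j <ᵇ toℕ j) = refl

  degree≡arcSum : ∀ t → degree G t ≡ arcSum (λ i _ → 𝟙 (does (i ≟ᶠ t)))
  degree≡arcSum t = sym (begin
      arcSum (λ i _ → 𝟙 (does (i ≟ᶠ t)))
        ≡⟨ sum-single t (λ i i≢t → trans (sum-cong-≗ (λ j → vanish i≢t (adj G i j)))
                                         (trans (sum-const n 0) (*-zeroʳ n))) ⟩
      sum (λ j → if adj G t j then 𝟙 (does (t ≟ᶠ t)) else 0)
        ≡⟨ cong (λ b → sum (λ j → if adj G t j then 𝟙 b else 0)) (dec-true (t ≟ᶠ t) refl) ⟩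
      sum (λ j → if adj G t j then 1 else 0)
        ≡⟨ sym (Σfin≡sum n _) ⟩
      degree G t ∎)
    where
    open ≡-Reasoning
    vanish : ∀ {i} → i ≢ t → ∀ b → (if b then 𝟙 (does (i ≟ᶠ t)) else 0) ≡ 0
    vanish i≢t true  = cong 𝟙 (dec-false (_ ≟ᶠ t) i≢t)
    vanish i≢t false = refl

  edgeSum-incident : ∀ t → edgeSum (λ i j → 𝟙 (does (i ≟ᶠ t)) + 𝟙 (does (j ≟ᶠ t))) ≡ degree G t
  edgeSum-incident t = begin
      edgeSum (λ i j → 𝟙 (does (i ≟ᶠ t)) + 𝟙 (does (j ≟ᶠ t)))
        ≡⟨ edgeSum-distrib-+ (λ i _ → 𝟙 (does (i ≟ᶠ t))) (λ _ j → 𝟙 (does (j ≟ᶠ t))) ⟩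
      edgeSum (λ i _ → 𝟙 (does (i ≟ᶠ t))) + edgeSum (λ _ j → 𝟙 (does (j ≟ᶠ t)))
        ≡⟨ edgeSum+edgeSum-flip≡arcSum (λ i _ → 𝟙 (does (i ≟ᶠ t))) ⟩
      arcSum (λ i _ → 𝟙 (does (i ≟ᶠ t)))
        ≡⟨ sym (degree≡arcSum t) ⟩
      degree G t ∎
    where open ≡-Reasoning

  arcSum-1≡2*edgeCount : arcSum (λ _ _ → 1) ≡ edgeCount G + edgeCount G
  arcSum-1≡2*edgeCount = trans (sym (edgeSum+edgeSum-flip≡arcSum (λ _ _ → 1)))
                               (sym (cong₂ _+_ (Σfin-edgeSum (λ _ _ → 1)) (Σfin-edgeSum (λ _ _ → 1))))

isZero≡does : ∀ {n} (i : Fin (suc n)) → isZero i ≡ does (i ≟ᶠ zero)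
isZero≡does zero    = refl
isZero≡does (suc i) = refl

star-iso : ∀ {n} (G : Graph n) (c : Fin n) → (∀ j → j ≢ c → adj G c j ≡ true) →
           (∀ {i j} → adj G i j ≡ true → i ≡ c ⊎ j ≡ c) → Isomorphic G (Star-graph n)
star-iso {suc n} G c centre-adj touches-centre =
  π , λ i j → trans (cong₂ _xor_ (sent-to-0 i) (sent-to-0 j)) (by-cases i j)
  where
  π = transpose c zero
  sent-to-0 : ∀ i → isZero (π ⟨$⟩ʳ i) ≡ does (i ≟ᶠ c)
  sent-to-0 i = trans (isZero≡does (π ⟨$⟩ʳ i)) (does-⇔ (mk⇔
    (λ πi≡0 → permutation-injective π {i} {c} (trans πi≡0 (sym (transpose-applyˡ c zero))))
    (λ { refl → transpose-applyˡ c zero })) (π ⟨$⟩ʳ i ≟ᶠ zero) (i ≟ᶠ c))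
  by-cases : ∀ i j → does (i ≟ᶠ c) xor does (j ≟ᶠ c) ≡ adj G i j
  by-cases i j with i ≟ᶠ c | j ≟ᶠ c
  ... | yes refl | yes refl = sym (loopless G i)
  ... | yes refl | no j≢c   = sym (centre-adj j j≢c)
  ... | no i≢c   | yes refl = sym (trans (adj-sym G i c) (centre-adj i i≢c))
  ... | no i≢c   | no j≢c   with adj G i j in ij
  ...   | false = refl
  ...   | true  = ⊥-elim ([ i≢c , j≢c ]′ (touches-centre ij))

-- Breadth-first search and trees

module BreadthFirstSearch {n} (G : Graph n) (r : Fin n)
                          (connected : ∀ v → Star (λ u w → adj G u w ≡ true) r v) where

  Within : ℕ → Fin n → Set
  Within zero    v = v ≡ r
  Within (suc k) v = Within k v ⊎ ∃ λ u → Within k u × adj G u v ≡ true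

  within? : ∀ k v → Dec (Within k v)
  within? zero    v = v ≟ᶠ r
  within? (suc k) v = within? k v ⊎-dec any? (λ u → within? k u ×-dec (adj G u v ≟ᵇ true))

  within-mono : ∀ {k k′ v} → k ≤ k′ → Within k v → Within k′ v
  within-mono {k′ = zero}   z≤n    w = w
  within-mono {k′ = suc k′} z≤n    w = inj₁ (within-mono z≤n w)
  within-mono {k′ = suc k′} (s≤s k≤k′) (inj₁ w)             = inj₁ (within-mono k≤k′ w)
  within-mono {k′ = suc k′} (s≤s k≤k′) (inj₂ (u , wu , uv)) = inj₂ (u , within-mono k≤k′ wu , uv)

  reachable : ∀ v → ∃ λ k → Within k v
  reachable v = along (connected v) refl
    where
    along : ∀ {a b k} → Star (λ u w → adj G u w ≡ true) a b → Within k a → ∃ λ k → Within k b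
    along ε            wa = _ , wa
    along (ab ◅ path) wa = along path (inj₂ (_ , wa , ab))

  private
    shortest : ∀ v → ∃ λ ℓ → Within ℓ v × (∀ {j} → j < ℓ → ¬ Within j v)
    shortest v = least-witness (λ k → within? k v) (proj₂ (reachable v))

  dist : Fin n → ℕ
  dist v = proj₁ (shortest v)

  within-dist : ∀ v → Within (dist v) v
  within-dist v = proj₁ (proj₂ (shortest v))

  dist-≤ : ∀ {k v} → Within k v → dist v ≤ k
  dist-≤ {k} {v} w = ≮⇒≥ λ k<dist → proj₂ (proj₂ (shortest v)) k<dist w

  dist-root : dist r ≡ 0
  dist-root = n≤0⇒n≡0 (dist-≤ refl)

  dist≡0⇒root : ∀ {v} → dist v ≡ 0 → v ≡ r
  dist≡0⇒root {v} d≡0 = subst (λ k → Within k v) d≡0 (within-dist v)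

  parent-exists : ∀ v → v ≢ r → ∃ λ u → dist v ≡ suc (dist u) × adj G u v ≡ true
  parent-exists v v≢r with dist v in dist-v | within-dist v
  ... | zero  | _ = ⊥-elim (v≢r (dist≡0⇒root dist-v))
  ... | suc k | inj₁ within-k = ⊥-elim (1+n≰n (subst (_≤ k) dist-v (dist-≤ within-k)))
  ... | suc k | inj₂ (u , within-u , uv) = u , cong suc (≤-antisym k≤dist-u (dist-≤ within-u)) , uv
    where
    k≤dist-u : k ≤ dist u
    k≤dist-u = ≮⇒≥ λ dist-u<k →
      1+n≰n (subst (_≤ k) dist-v (dist-≤ (within-mono dist-u<k (inj₂ (u , within-dist u , uv)))))

  parent : Fin n → Fin n
  parent v with v ≟ᶠ r
  ... | yes _   = r
  ... | no  v≢r = proj₁ (parent-exists v v≢r)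

  dist-parent : ∀ {v} → v ≢ r → dist v ≡ suc (dist (parent v))
  dist-parent {v} v≢r with v ≟ᶠ r
  ... | yes v≡r  = ⊥-elim (v≢r v≡r)
  ... | no  v≢r′ = proj₁ (proj₂ (parent-exists v v≢r′))

  adj-parent : ∀ {v} → v ≢ r → adj G (parent v) v ≡ true
  adj-parent {v} v≢r with v ≟ᶠ r
  ... | yes v≡r  = ⊥-elim (v≢r v≡r)
  ... | no  v≢r′ = proj₂ (proj₂ (parent-exists v v≢r′))

module RootedTree {n} (T : Graph n) (tree : IsTree T) (r : Fin n) where

  open BreadthFirstSearch T r (proj₁ tree r) public

  ParentOf : Fin n → Fin n → Set
  ParentOf u v = v ≢ r × parent v ≡ u

  parentOf? : ∀ u v → Dec (ParentOf u v)
  parentOf? u v = ¬? (v ≟ᶠ r) ×-dec (parent v ≟ᶠ u)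

  dist-parentOf : ∀ {u v} → ParentOf u v → dist v ≡ suc (dist u)
  dist-parentOf (v≢r , refl) = dist-parent v≢r

  parentOf-asym : ∀ {u v} → ParentOf u v → ¬ ParentOf v u
  parentOf-asym uv vu =
    1+n≰n (≤-trans (n≤1+n _) (≤-reflexive (sym (trans (dist-parentOf uv) (cong suc (dist-parentOf vu))))))

  parentOf⇒adj : ∀ {u v} → ParentOf u v → adj T u v ≡ true
  parentOf⇒adj (v≢r , refl) = adj-parent v≢r

  private
    parentArcs : Fin n → Fin n → ℕ
    parentArcs u v = 𝟙 (does (parentOf? u v)) + 𝟙 (does (parentOf? v u))

    parentArcs≤adj : ∀ u v → parentArcs u v ≤ (if adj T u v then 1 else 0)
    parentArcs≤adj u v = bound (parentOf? u v) (parentOf? v u)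
      where
      bound : (uv? : Dec (ParentOf u v)) (vu? : Dec (ParentOf v u)) →
              𝟙 (does uv?) + 𝟙 (does vu?) ≤ (if adj T u v then 1 else 0)
      bound (yes uv) (yes vu) = ⊥-elim (parentOf-asym uv vu)
      bound (yes uv) (no _)   rewrite parentOf⇒adj uv = ≤-refl
      bound (no _)   (yes vu) rewrite adj-sym T u v | parentOf⇒adj vu = ≤-refl
      bound (no _)   (no _)   = z≤n

    parents-of : ∀ v → sum (λ u → 𝟙 (does (parentOf? u v))) ≡ 𝟙 (does (¬? (v ≟ᶠ r)))
    parents-of v =
      trans (sum-single (parent v) λ u u≢pv → cong 𝟙 (dec-false (parentOf? u v) (u≢pv ∘ sym ∘ proj₂)))
            (trans (cong (λ b → 𝟙 (not (does (v ≟ᶠ r)) ∧ b)) (dec-true (parent v ≟ᶠ parent v) refl))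
                   (cong 𝟙 (∧-identityʳ _)))

    non-roots : sum (λ v → 𝟙 (does (¬? (v ≟ᶠ r)))) ≡ edgeCount T
    non-roots = suc-injective (begin
        suc (sum nonRoot)                         ≡⟨ +-comm 1 _ ⟩
        sum nonRoot + 1                           ≡⟨ cong (sum nonRoot +_) (sym (sum-𝟙-≡ r)) ⟩
        sum nonRoot + sum isRoot                  ≡⟨ sym (∑-distrib-+ nonRoot isRoot) ⟩
        sum (λ v → nonRoot v + isRoot v)          ≡⟨ sum-cong-≗ one ⟩
        sum {n} (λ _ → 1)                         ≡⟨ trans (sum-const n 1) (*-identityʳ n) ⟩
        n                                         ≡⟨ sym (proj₂ tree) ⟩
        suc (edgeCount T)                         ∎)
      where
      open ≡-Reasoning
      nonRoot isRoot : Fin n → ℕ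
      nonRoot v = 𝟙 (does (¬? (v ≟ᶠ r)))
      isRoot  v = 𝟙 (does (v ≟ᶠ r))
      one : ∀ v → nonRoot v + isRoot v ≡ 1
      one v with v ≟ᶠ r
      ... | yes _ = refl
      ... | no  _ = refl

    parentArcs-total : sum (λ u → sum (parentArcs u)) ≡ arcSum T (λ _ _ → 1)
    parentArcs-total = begin
        sum (λ u → sum (parentArcs u))
          ≡⟨ trans (sum-cong-≗ λ u → ∑-distrib-+ (P u) (λ v → P v u))
                   (∑-distrib-+ (λ u → sum (P u)) (λ u → sum (λ v → P v u))) ⟩
        sum (λ u → sum (P u)) + sum (λ u → sum (λ v → P v u))
          ≡⟨ cong (_+ sum (λ u → sum (λ v → P v u))) (∑-comm P) ⟩
        sum (λ v → sum (λ u → P u v)) + sum (λ u → sum (λ v → P v u))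
          ≡⟨ cong₂ _+_ (trans (sum-cong-≗ parents-of) non-roots)
                       (trans (sum-cong-≗ parents-of) non-roots) ⟩
        edgeCount T + edgeCount T
          ≡⟨ sym (arcSum-1≡2*edgeCount T) ⟩
        arcSum T (λ _ _ → 1) ∎
      where
      open ≡-Reasoning
      P : Fin n → Fin n → ℕ
      P u v = 𝟙 (does (parentOf? u v))

  -- The n - 1 parent edges are distinct (ParentOf is asymmetric) and there are only n - 1 edges.
  edge⇒parentOf : ∀ {u v} → adj T u v ≡ true → ParentOf u v ⊎ ParentOf v u
  edge⇒parentOf {u} {v} uv = one-of (parentOf? u v) (parentOf? v u) (trans (parentArcs≡adj u v) (cong 𝟙 uv))
    where
    parentArcs≡adj : ∀ u v → parentArcs u v ≡ (if adj T u v then 1 else 0)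
    parentArcs≡adj u = sum-≡⇒≗ (parentArcs≤adj u)
      (sum-≡⇒≗ (λ u → sum-mono-≤ (parentArcs≤adj u)) parentArcs-total u)
    one-of : (uv? : Dec (ParentOf u v)) (vu? : Dec (ParentOf v u)) → 𝟙 (does uv?) + 𝟙 (does vu?) ≡ 1 →
             ParentOf u v ⊎ ParentOf v u
    one-of (yes uv) _        _ = inj₁ uv
    one-of (no _)   (yes vu) _ = inj₂ vu

  adj⇒dist-suc : ∀ {u v} → adj T u v ≡ true → dist v ≡ suc (dist u) ⊎ dist u ≡ suc (dist v)
  adj⇒dist-suc uv with edge⇒parentOf uv
  ... | inj₁ u-parent = inj₁ (dist-parentOf u-parent)
  ... | inj₂ v-parent = inj₂ (dist-parentOf v-parent)

  adj⇒parity-≢ : ∀ {u v} → adj T u v ≡ true → parity (dist u) ≢ parity (dist v)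
  adj⇒parity-≢ {u} {v} uv with adj⇒dist-suc uv
  ... | inj₁ dv≡1+du = λ eq → p≢p⁻¹ _ (trans eq (trans (cong parity dv≡1+du) (parity-suc (dist u))))
  ... | inj₂ du≡1+dv = λ eq → p≢p⁻¹ _ (trans (sym eq) (trans (cong parity du≡1+dv) (parity-suc (dist v))))

  ∃-ancestor : ∀ {k} v → k ≤ dist v → ∃ λ u → dist u ≡ k
  ∃-ancestor v = go (dist v) v refl
    where
    go : ∀ d {k} v → dist v ≡ d → k ≤ d → ∃ λ u → dist u ≡ k
    go zero    v dv z≤n = v , dv
    go (suc d) {k} v dv k≤1+d with k ≟ suc d
    ... | yes refl = v , dv
    ... | no  k≢1+d =
      go d (parent v) (suc-injective (trans (sym (dist-parent v≢r)) dv)) (≤-pred (≤∧≢⇒< k≤1+d k≢1+d))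
      where
      v≢r : v ≢ r
      v≢r refl = 0≢1+n (trans (sym dist-root) dv)

  star-centred : ∀ c → (c ≢ r → parent c ≡ r) → (∀ v → v ≢ r → v ≢ c → parent v ≡ c) →
                 Isomorphic T (Star-graph n)
  star-centred c parent-c parent-others = star-iso T c centre-adj touches-centre
    where
    centre-adj : ∀ j → j ≢ c → adj T c j ≡ true
    centre-adj j j≢c with j ≟ᶠ r
    ... | yes refl = trans (adj-sym T c r) (parentOf⇒adj (j≢c ∘ sym , parent-c (j≢c ∘ sym)))
    ... | no  j≢r  = parentOf⇒adj (j≢r , parent-others j j≢r j≢c)
    touches-parent : ∀ {i j} → ParentOf i j → i ≡ c ⊎ j ≡ c
    touches-parent {i} {j} (j≢r , parent-j) with j ≟ᶠ c
    ... | yes j≡c = inj₂ j≡c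
    ... | no  j≢c = inj₁ (trans (sym parent-j) (parent-others j j≢r j≢c))
    touches-centre : ∀ {i j} → adj T i j ≡ true → i ≡ c ⊎ j ≡ c
    touches-centre ij with edge⇒parentOf ij
    ... | inj₁ i-parent = touches-parent i-parent
    ... | inj₂ j-parent = swap (touches-parent j-parent)

  star-if-unique-odd : ∀ {p} → dist p ≡ 1 → (∀ {v} → parity (dist v) ≡ 1ℙ → v ≡ p) → Isomorphic T (Star-graph n)
  star-if-unique-odd {p} dist-p odd⇒p = star-centred p parent-p parent-others
    where
    parent-p : p ≢ r → parent p ≡ r
    parent-p p≢r = dist≡0⇒root (suc-injective (trans (sym (dist-parent p≢r)) dist-p))
    parent-others : ∀ v → v ≢ r → v ≢ p → parent v ≡ p
    parent-others v v≢r v≢p with parity (dist (parent v)) in parent-parity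
    ... | 1ℙ = odd⇒p parent-parity
    ... | 0ℙ = ⊥-elim (v≢p (odd⇒p (trans (cong parity (dist-parent v≢r))
                                     (trans (parity-suc (dist (parent v))) (cong _⁻¹ parent-parity)))))

  module _ (non-star : ¬ Isomorphic T (Star-graph n)) where

    ∃-far : ∃ λ s → 2 ≤ dist s
    ∃-far with any? (λ s → 2 ≤? dist s)
    ... | yes far = far
    ... | no  ¬far = ⊥-elim (non-star (star-centred r (λ r≢r → ⊥-elim (r≢r refl)) λ v v≢r _ →
            dist≡0⇒root (suc-injective (trans (sym (dist-parent v≢r)) (dist≡1 v v≢r)))))
      where
      dist≡1 : ∀ v → v ≢ r → dist v ≡ 1
      dist≡1 v v≢r with dist v in dv
      ... | zero        = ⊥-elim (v≢r (dist≡0⇒root dv))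
      ... | suc zero    = refl
      ... | suc (suc k) = ⊥-elim (¬far (v , subst (2 ≤_) (sym dv) (s≤s (s≤s z≤n))))

    ∃-non-neighbour : ∃ λ s → s ≢ r × adj T r s ≡ false
    ∃-non-neighbour with ∃-far
    ... | s , 2≤s = s , s≢r , ¬-not non-adj
      where
      s≢r : s ≢ r
      s≢r refl = 1+n≰n (≤-trans (n≤1+n 1) (subst (2 ≤_) dist-root 2≤s))
      non-adj : adj T r s ≢ true
      non-adj rs with adj⇒dist-suc rs
      ... | inj₁ ds≡1+dr = 1+n≰n (subst (2 ≤_) (trans ds≡1+dr (cong suc dist-root)) 2≤s)
      ... | inj₂ dr≡1+ds = 0≢1+n (trans (sym dist-root) dr≡1+ds)

    ∃-nonadjacent-across : ∃₂ λ a b → parity (dist a) ≡ 0ℙ × parity (dist b) ≡ 1ℙ × adj T a b ≡ false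
    ∃-nonadjacent-across = search (any? λ q → (parity (dist q) ≟ᵖ 1ℙ) ×-dec ¬? (q ≟ᶠ p))
      where
      w : Fin n
      w = proj₁ (∃-ancestor (proj₁ ∃-far) (proj₂ ∃-far))
      dist-w : dist w ≡ 2
      dist-w = proj₂ (∃-ancestor (proj₁ ∃-far) (proj₂ ∃-far))
      w≢r : w ≢ r
      w≢r w≡r = 0≢1+n (trans (sym dist-root) (trans (cong dist (sym w≡r)) dist-w))
      p : Fin n
      p = parent w
      dist-p : dist p ≡ 1
      dist-p = suc-injective (trans (sym (dist-parent w≢r)) dist-w)
      search : Dec (∃ λ q → parity (dist q) ≡ 1ℙ × q ≢ p) →
               ∃₂ λ a b → parity (dist a) ≡ 0ℙ × parity (dist b) ≡ 1ℙ × adj T a b ≡ false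
      search (yes (q , odd-q , q≢p)) with dist q ≟ 1
      ... | yes dist-q = w , q , cong parity dist-w , odd-q , ¬-not non-adj
        where
        non-adj : adj T w q ≢ true
        non-adj wq with edge⇒parentOf wq
        ... | inj₁ w-parent =
          0≢1+n (suc-injective (trans (sym dist-q) (trans (dist-parentOf w-parent) (cong suc dist-w))))
        ... | inj₂ (_ , parent-w≡q) = q≢p (sym parent-w≡q)
      ... | no dist-q≢1 = r , q , cong parity dist-root , odd-q , ¬-not non-adj
        where
        non-adj : adj T r q ≢ true
        non-adj rq with adj⇒dist-suc rq
        ... | inj₁ dq≡1+dr = dist-q≢1 (trans dq≡1+dr (cong suc dist-root))
        ... | inj₂ dr≡1+dq = 0≢1+n (trans (sym dist-root) dr≡1+dq)
      search (no only-p-odd) = ⊥-elim (non-star (star-if-unique-odd dist-p odd⇒p))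
        where
        odd⇒p : ∀ {v} → parity (dist v) ≡ 1ℙ → v ≡ p
        odd⇒p {v} odd-v with v ≟ᶠ p
        ... | yes v≡p = v≡p
        ... | no  v≢p = ⊥-elim (only-p-odd (v , odd-v , v≢p))

-- Embedding a non-star tree while avoiding a matching

module _ {m} (β : Fin m → Fin m) (β-involutive : ∀ v → β (β v) ≡ v) where

  -- A matched pair v < β v gets the consecutive keys 2v and 2v + 1; an unmatched v gets 2v.
  matchingKey : Fin m → ℕ
  matchingKey v = if toℕ (β v) <ᵇ toℕ v then suc (toℕ (β v) + toℕ (β v)) else toℕ v + toℕ v

  matchingKey-injective : Injective _≡_ _≡_ matchingKey
  matchingKey-injective {v} {w} = by-cases (toℕ (β v) <? toℕ v) (toℕ (β w) <? toℕ w)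
    where
    by-cases : (βv<v? : Dec (toℕ (β v) < toℕ v)) (βw<w? : Dec (toℕ (β w) < toℕ w)) →
               (if does βv<v? then suc (toℕ (β v) + toℕ (β v)) else toℕ v + toℕ v) ≡
               (if does βw<w? then suc (toℕ (β w) + toℕ (β w)) else toℕ w + toℕ w) → v ≡ w
    by-cases (yes _) (yes _) eq = trans (sym (β-involutive v))
      (trans (cong β (toℕ-injective (double-injective (suc-injective eq)))) (β-involutive w))
    by-cases (yes _) (no  _) eq = ⊥-elim (odd≢double (toℕ (β v)) (toℕ w) eq)
    by-cases (no  _) (yes _) eq = ⊥-elim (odd≢double (toℕ (β w)) (toℕ v) (sym eq))
    by-cases (no  _) (no  _) eq = toℕ-injective (double-injective eq)

  matchingKey-consecutive : ∀ v → toℕ v < toℕ (β v) → matchingKey (β v) ≡ suc (matchingKey v)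
  matchingKey-consecutive v v<βv rewrite <ᵇ-false (<⇒≯ v<βv) | β-involutive v | <ᵇ-true v<βv = refl

EdgesNonConsecutive : ∀ {n} → Graph n → (Fin n → ℕ) → Set
EdgesNonConsecutive G key = ∀ {i j} → adj G i j ≡ true → rank key j ≢ suc (rank key i)

EmbeddingAvoiding : ∀ {n m} → Graph n → (Fin m → Fin m) → Set
EmbeddingAvoiding {n} {m} G β =
  ∃ λ (φ : Fin n → Fin m) → Injective _≡_ _≡_ φ × (∀ {i j} → adj G i j ≡ true → φ j ≢ β (φ i))

embedding-avoiding-matching : ∀ {n m} → n ≤ m → (G : Graph n) (key : Fin n → ℕ) → Injective _≡_ _≡_ key →
                              EdgesNonConsecutive G key → (β : Fin m → Fin m) → (∀ v → β (β v) ≡ v) →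
                              EmbeddingAvoiding G β
embedding-avoiding-matching {n} {m} n≤m G key key-injective edges-not-consecutive β β-involutive =
  φ , φ-injective , avoids
  where
  keyK = matchingKey β β-involutive
  keyK-injective = matchingKey-injective β β-involutive
  same-rank : ∀ i → ∃ λ v → rank keyK v ≡ rank key i
  same-rank i = rank-surjective keyK keyK-injective (rank key i) (<-≤-trans (rank<N key i) n≤m)
  φ : Fin n → Fin m
  φ i = proj₁ (same-rank i)
  rank-φ : ∀ i → rank keyK (φ i) ≡ rank key i
  rank-φ i = proj₂ (same-rank i)
  φ-injective : Injective _≡_ _≡_ φ
  φ-injective {i} {j} eq =
    rank-injective key key-injective (trans (sym (rank-φ i)) (trans (cong (rank keyK) eq) (rank-φ j)))
  matched⇒consecutive : ∀ {i j} → φ j ≡ β (φ i) → toℕ (φ i) < toℕ (φ j) → rank key j ≡ suc (rank key i)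
  matched⇒consecutive {i} {j} φj≡βφi φi<φj = begin
      rank key j              ≡⟨ sym (rank-φ j) ⟩
      rank keyK (φ j)         ≡⟨ cong (rank keyK) φj≡βφi ⟩
      rank keyK (β (φ i))     ≡⟨ key-consecutive⇒rank-consecutive keyK keyK-injective {φ i} {β (φ i)}
                                   (matchingKey-consecutive β β-involutive (φ i)
                                     (subst (λ x → toℕ (φ i) < toℕ x) φj≡βφi φi<φj)) ⟩
      suc (rank keyK (φ i))   ≡⟨ cong suc (rank-φ i) ⟩
      suc (rank key i)        ∎
    where open ≡-Reasoning
  avoids : ∀ {i j} → adj G i j ≡ true → φ j ≢ β (φ i)
  avoids {i} {j} ij φj≡βφi with <-cmp (toℕ (φ i)) (toℕ (φ j))
  ... | tri< φi<φj _ _ = edges-not-consecutive ij (matched⇒consecutive φj≡βφi φi<φj)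
  ... | tri> _ _ φj<φi = edges-not-consecutive (trans (adj-sym G j i) ij)
                           (matched⇒consecutive (sym (trans (cong β φj≡βφi) (β-involutive (φ i)))) φj<φi)
  ... | tri≈ _ φi≡φj _ = adj⇒≢ G ij (φ-injective (toℕ-injective φi≡φj))

module BipartiteOrder {n} (G : Graph n) (χ : Fin n → Parity)
                      (proper : ∀ {i j} → adj G i j ≡ true → χ i ≢ χ j)
                      {a b : Fin n} (χa : χ a ≡ 0ℙ) (χb : χ b ≡ 1ℙ) (a≁b : adj G a b ≡ false) where

  -- Class 0ℙ comes first and ends with a, class 1ℙ follows and starts with b; as a and b are not
  -- adjacent and each class is independent, consecutive vertices are never adjacent.
  classKey : Parity → Fin n → ℕ
  classKey 0ℙ i = if does (i ≟ᶠ a) then n else toℕ i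
  classKey 1ℙ i = suc n + (if does (i ≟ᶠ b) then 0 else suc (toℕ i))

  key : Fin n → ℕ
  key i = classKey (χ i) i

  private
    key≡ : ∀ {i p} → χ i ≡ p → key i ≡ classKey p i
    key≡ {i} = cong (λ p → classKey p i)

    classKey-0ℙ≤n : ∀ i → classKey 0ℙ i ≤ n
    classKey-0ℙ≤n i with i ≟ᶠ a
    ... | yes _ = ≤-refl
    ... | no  _ = <⇒≤ (toℕ<n i)

    classKey-0ℙ-injective : Injective _≡_ _≡_ (classKey 0ℙ)
    classKey-0ℙ-injective {i} {j} eq with i ≟ᶠ a | j ≟ᶠ a
    ... | yes i≡a | yes j≡a = trans i≡a (sym j≡a)
    ... | yes _   | no  _   = ⊥-elim (<-irrefl (sym eq) (toℕ<n j))
    ... | no  _   | yes _   = ⊥-elim (<-irrefl eq (toℕ<n i))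
    ... | no  _   | no  _   = toℕ-injective eq

    classKey-1ℙ-injective : Injective _≡_ _≡_ (classKey 1ℙ)
    classKey-1ℙ-injective {i} {j} eq with i ≟ᶠ b | j ≟ᶠ b | +-cancelˡ-≡ (suc n) _ _ eq
    ... | yes i≡b | yes j≡b | _  = trans i≡b (sym j≡b)
    ... | no  _   | no  _   | eq′ = toℕ-injective (suc-injective eq′)

  across : ∀ {i j} → χ i ≡ 0ℙ → χ j ≡ 1ℙ → key i < key j
  across {i} {j} χi χj rewrite key≡ χi | key≡ χj = s≤s (≤-trans (classKey-0ℙ≤n i) (m≤m+n n _))

  below-a : ∀ {i} → χ i ≡ 0ℙ → i ≢ a → key i < key a
  below-a {i} χi i≢a rewrite key≡ χi | key≡ χa | dec-false (i ≟ᶠ a) i≢a | dec-true (a ≟ᶠ a) refl =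
    toℕ<n i

  above-b : ∀ {j} → χ j ≡ 1ℙ → j ≢ b → key b < key j
  above-b {j} χj j≢b rewrite key≡ χj | key≡ χb | dec-false (j ≟ᶠ b) j≢b | dec-true (b ≟ᶠ b) refl =
    +-monoʳ-< (suc n) z<s

  key-injective : Injective _≡_ _≡_ key
  key-injective {i} {j} eq = by-class (χ i) (χ j) refl refl
    where
    by-class : ∀ p q → χ i ≡ p → χ j ≡ q → i ≡ j
    by-class 0ℙ 0ℙ χi χj = classKey-0ℙ-injective (trans (sym (key≡ χi)) (trans eq (key≡ χj)))
    by-class 1ℙ 1ℙ χi χj = classKey-1ℙ-injective (trans (sym (key≡ χi)) (trans eq (key≡ χj)))
    by-class 0ℙ 1ℙ χi χj = ⊥-elim (<-irrefl eq (across χi χj))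
    by-class 1ℙ 0ℙ χi χj = ⊥-elim (<-irrefl (sym eq) (across χj χi))

  edges-not-consecutive : EdgesNonConsecutive G key
  edges-not-consecutive {i} {j} ij consecutive = by-class (χ i) (χ j) refl refl
    where
    no-between : ∀ {u} → key i < key u → key u < key j → ⊥
    no-between = rank-consecutive-no-between key consecutive
    by-class : ∀ p q → χ i ≡ p → χ j ≡ q → ⊥
    by-class 0ℙ 0ℙ χi χj = proper ij (trans χi (sym χj))
    by-class 1ℙ 1ℙ χi χj = proper ij (trans χi (sym χj))
    by-class 1ℙ 0ℙ χi χj = <-asym (across χj χi) (rank-consecutive⇒key< key key-injective consecutive)
    by-class 0ℙ 1ℙ χi χj with i ≟ᶠ a | j ≟ᶠ b
    ... | no  i≢a | _        = no-between (below-a χi i≢a) (across χa χj)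
    ... | yes refl | no j≢b  = no-between (across χa χb) (above-b χj j≢b)
    ... | yes refl | yes refl with trans (sym ij) a≁b
    ...   | ()

non-star-tree-avoids-matching :
  ∀ {n m} (T : Graph n) → IsTree T → ¬ Isomorphic T (Star-graph n) → n ≤ m →
  (β : Fin m → Fin m) → (∀ v → β (β v) ≡ v) → EmbeddingAvoiding T β
non-star-tree-avoids-matching {n} T tree non-star n≤m β β-involutive =
  let _ , _ , χa , χb , a≁b = ∃-nonadjacent-across non-star
      open BipartiteOrder T (parity ∘ dist) adj⇒parity-≢ χa χb a≁b
  in embedding-avoiding-matching n≤m T key key-injective edges-not-consecutive β β-involutive
  where open RootedTree T tree (subst Fin (proj₂ tree) zero)

-- Restrictive colourings

DiscordantPairsIntersect : ∀ {m} {A : Set} → (Fin m → A) → Set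
DiscordantPairsIntersect d =
  ∀ {p q r s} → d p ≢ d q → d r ≢ d s → p ≢ r → p ≢ s → q ≢ r → q ≢ s → ⊥

constant-off-one-point : ∀ {m} {A : Set} (d : Fin m → A) → DecidableEquality A → 4 ≤ m →
                         DiscordantPairsIntersect d → ∃₂ λ c D → ∀ w → w ≢ D → d w ≡ c
constant-off-one-point {m} d _≟ₐ_ 4≤m intersect with any? (λ p → any? (λ q → ¬? (d p ≟ₐ d q)))
... | no constant = d z , z , λ w _ → decidable-stable (d w ≟ₐ d z) (λ dw≢dz → constant (w , z , dw≢dz))
  where z = proj₁ (∃-∉ [] (≤-trans (s≤s z≤n) 4≤m))
... | yes (p , q , dp≢dq) = off-one-point (d p ≟ₐ d r)
  where
  r∉ = proj₂ (∃-∉ (p ∷ q ∷ []) (≤-trans (s≤s (s≤s (s≤s z≤n))) 4≤m))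
  r = proj₁ (∃-∉ (p ∷ q ∷ []) (≤-trans (s≤s (s≤s (s≤s z≤n))) 4≤m))
  p≢q : p ≢ q
  p≢q refl = dp≢dq refl
  p≢r : p ≢ r
  p≢r p≡r = r∉ (here (sym p≡r))
  q≢r : q ≢ r
  q≢r q≡r = r∉ (there (here (sym q≡r)))
  agree : ∀ w → w ≢ p → w ≢ q → d w ≡ d r
  agree w w≢p w≢q with d w ≟ₐ d r
  ... | yes dw≡dr = dw≡dr
  ... | no  dw≢dr = ⊥-elim (intersect dp≢dq (dw≢dr ∘ sym) p≢r (w≢p ∘ sym) q≢r (w≢q ∘ sym))
  off-one-point : Dec (d p ≡ d r) → ∃₂ λ c D → ∀ w → w ≢ D → d w ≡ c
  off-one-point (yes dp≡dr) = d r , q , except-q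
    where
    except-q : ∀ w → w ≢ q → d w ≡ d r
    except-q w w≢q with w ≟ᶠ p
    ... | yes refl = dp≡dr
    ... | no  w≢p  = agree w w≢p w≢q
  off-one-point (no dp≢dr) = d r , p , except-p
    where
    s∉ = proj₂ (∃-∉ (p ∷ q ∷ r ∷ []) 4≤m)
    s = proj₁ (∃-∉ (p ∷ q ∷ r ∷ []) 4≤m)
    dq≡dr : d q ≡ d r
    dq≡dr with d q ≟ₐ d s
    ... | yes dq≡ds = trans dq≡ds (agree s (λ e → s∉ (here e)) (λ e → s∉ (there (here e))))
    ... | no  dq≢ds = ⊥-elim (intersect dp≢dr dq≢ds p≢q (λ e → s∉ (here (sym e)))
                                 (q≢r ∘ sym) (λ e → s∉ (there (there (here (sym e))))))
    except-p : ∀ w → w ≢ p → d w ≡ d r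
    except-p w w≢p with w ≟ᶠ q
    ... | yes refl = dq≡dr
    ... | no  w≢q  = agree w w≢p w≢q

module RestrictiveColouring {m} (f : Colouring m) (restrictive : Restrictive f) where

  dominant : Fin m → Fin 3
  dominant v = proj₁ (restrictive v)

  Exceptional : Fin m → Fin m → Set
  Exceptional v w = v ≢ w × col f v w ≢ dominant v

  exceptional? : ∀ v w → Dec (Exceptional v w)
  exceptional? v w = ¬? (v ≟ᶠ w) ×-dec ¬? (col f v w ≟ᶠ dominant v)

  exceptional-unique : ∀ {v w w′} → Exceptional v w → Exceptional v w′ → w ≡ w′
  exceptional-unique {v} {w} {w′} (v≢w , vw) (v≢w′ , vw′) with w ≟ᶠ w′
  ... | yes w≡w′ = w≡w′
  ... | no  w≢w′ = ⊥-elim (1+n≰n (≤-trans (≤-reflexive (+-comm 3 (countFin m typical)))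
                                  (≤-trans (countFin-three-misses typical v≢w v≢w′ w≢w′ at-v at-w at-w′)
                                           (proj₂ (restrictive v)))))
    where
    typical : Fin m → Bool
    typical x = not ⌊ v ≟ᶠ x ⌋ ∧ ⌊ col f v x ≟ᶠ dominant v ⌋
    at-v : typical v ≡ false
    at-v rewrite isYes≗does (v ≟ᶠ v) | dec-true (v ≟ᶠ v) refl = refl
    at-w : typical w ≡ false
    at-w rewrite isYes≗does (col f v w ≟ᶠ dominant v) | dec-false (col f v w ≟ᶠ dominant v) vw =
      ∧-zeroʳ _
    at-w′ : typical w′ ≡ false
    at-w′ rewrite isYes≗does (col f v w′ ≟ᶠ dominant v) | dec-false (col f v w′ ≟ᶠ dominant v) vw′ =
      ∧-zeroʳ _

  unexceptional-colour : ∀ {v w} → v ≢ w → ¬ Exceptional v w → col f v w ≡ dominant v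
  unexceptional-colour {v} {w} v≢w ¬exc =
    decidable-stable (col f v w ≟ᶠ dominant v) (λ vw → ¬exc (v≢w , vw))

  exceptional-towards : ∀ {z x} → z ≢ x → ¬ Exceptional x z → dominant z ≢ dominant x → Exceptional z x
  exceptional-towards {z} {x} z≢x ¬exc dz≢dx =
    z≢x , λ zx → dz≢dx (trans (sym zx) (trans (colSym f z x) (unexceptional-colour (z≢x ∘ sym) ¬exc)))

  partner : Fin m → Fin m
  partner v with any? (exceptional? v)
  ... | yes (w , _) = w
  ... | no  _       = v

  exceptional⇒partner : ∀ {v w} → Exceptional v w → w ≡ partner v
  exceptional⇒partner {v} exc with any? (exceptional? v)
  ... | yes (w , exc′) = exceptional-unique exc exc′
  ... | no  none       = ⊥-elim (none (_ , exc))

  partner-cases : ∀ v → partner v ≡ v ⊎ Exceptional v (partner v)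
  partner-cases v with any? (exceptional? v)
  ... | yes (_ , exc) = inj₂ exc
  ... | no  _         = inj₁ refl

  discordant⇒exceptional : ∀ {p q} → dominant p ≢ dominant q → Exceptional p q ⊎ Exceptional q p
  discordant⇒exceptional {p} {q} dp≢dq with exceptional? p q | exceptional? q p
  ... | yes pq | _      = inj₁ pq
  ... | no  _  | yes qp = inj₂ qp
  ... | no ¬pq | no ¬qp = ⊥-elim (dp≢dq (trans (sym (unexceptional-colour p≢q ¬pq))
                                        (trans (colSym f p q) (unexceptional-colour (p≢q ∘ sym) ¬qp))))
    where
    p≢q : p ≢ q
    p≢q refl = dp≢dq refl

  attracted-by-discordant : ∀ {p q z} → dominant p ≢ dominant q → z ≢ p → z ≢ q →
                            ¬ Exceptional p z → ¬ Exceptional q z → Exceptional z p ⊎ Exceptional z q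
  attracted-by-discordant {p} {q} {z} dp≢dq z≢p z≢q ¬pz ¬qz with dominant z ≟ᶠ dominant p
  ... | no  dz≢dp = inj₁ (exceptional-towards z≢p ¬pz dz≢dp)
  ... | yes dz≡dp = inj₂ (exceptional-towards z≢q ¬qz (dp≢dq ∘ trans (sym dz≡dp)))

  discordant-pair-attracts : ∀ {p q} → dominant p ≢ dominant q →
    ∃ λ x → ∀ {z} → z ≢ p → z ≢ q → z ≢ x → Exceptional z p ⊎ Exceptional z q
  discordant-pair-attracts {p} {q} dp≢dq with discordant⇒exceptional dp≢dq
  ... | inj₁ pq = partner q , λ z≢p z≢q z≢x → attracted-by-discordant dp≢dq z≢p z≢q
                                 (λ pz → z≢q (exceptional-unique pz pq)) (z≢x ∘ exceptional⇒partner)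
  ... | inj₂ qp = partner p , λ z≢p z≢q z≢x → attracted-by-discordant dp≢dq z≢p z≢q
                                 (z≢x ∘ exceptional⇒partner) (λ qz → z≢p (exceptional-unique qz qp))

  discordant-pairs-intersect : 7 ≤ m → DiscordantPairsIntersect dominant
  discordant-pairs-intersect 7≤m {p} {q} {r} {s} dp≢dq dr≢ds p≢r p≢s q≢r q≢s
    with discordant-pair-attracts dp≢dq | discordant-pair-attracts dr≢ds
  ... | x , attract-pq | y , attract-rs
    with ∃-∉ (p ∷ q ∷ r ∷ s ∷ x ∷ y ∷ []) 7≤m
  ... | z , z∉ = meet (attract-pq (z∉ ∘ here) (z∉ ∘ there ∘ here)
                                  (z∉ ∘ there ∘ there ∘ there ∘ there ∘ here))
                      (attract-rs (z∉ ∘ there ∘ there ∘ here) (z∉ ∘ there ∘ there ∘ there ∘ here)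
                                  (z∉ ∘ there ∘ there ∘ there ∘ there ∘ there ∘ here))
    where
    meet : Exceptional z p ⊎ Exceptional z q → Exceptional z r ⊎ Exceptional z s → ⊥
    meet (inj₁ zp) (inj₁ zr) = p≢r (exceptional-unique zp zr)
    meet (inj₁ zp) (inj₂ zs) = p≢s (exceptional-unique zp zs)
    meet (inj₂ zq) (inj₁ zr) = q≢r (exceptional-unique zq zr)
    meet (inj₂ zq) (inj₂ zs) = q≢s (exceptional-unique zq zs)

  dominant-constant-off-one-point : 7 ≤ m → ∃₂ λ c D → ∀ w → w ≢ D → dominant w ≡ c
  dominant-constant-off-one-point 7≤m =
    constant-off-one-point dominant _≟ᶠ_ (≤-trans (s≤s (s≤s (s≤s (s≤s z≤n)))) 7≤m)
                           (discordant-pairs-intersect 7≤m)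

  module Uniform {c} (all-c : ∀ w → dominant w ≡ c) where

    partner-involutive : ∀ v → partner (partner v) ≡ v
    partner-involutive v with partner-cases v
    ... | inj₁ pv≡v        = trans (cong partner pv≡v) pv≡v
    ... | inj₂ (v≢pv , vpv) = sym (exceptional⇒partner ((v≢pv ∘ sym) ,
            λ pvv → vpv (trans (colSym f v (partner v)) (trans pvv (trans (all-c _) (sym (all-c v)))))))

    colour-off-partner : ∀ {u v} → u ≢ v → v ≢ partner u → col f u v ≡ c
    colour-off-partner {u} {v} u≢v v≢pu =
      trans (unexceptional-colour u≢v (v≢pu ∘ exceptional⇒partner)) (all-c u)

  module OneOff {c D} (others-c : ∀ w → w ≢ D → dominant w ≡ c) (D-differs : dominant D ≢ c) where

    colour-off-D : ∀ {x y} → x ≢ D → y ≢ D → x ≢ y → col f x y ≡ c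
    colour-off-D {x} {y} x≢D y≢D x≢y with col f x y ≟ᶠ c
    ... | yes xy≡c = xy≡c
    ... | no  xy≢c = ⊥-elim (x≢y (trans (partner-of-D x≢D y≢D xy) (sym (partner-of-D y≢D x≢D yx))))
      where
      xy : Exceptional x y
      xy = x≢y , λ xy≡dx → xy≢c (trans xy≡dx (others-c x x≢D))
      yx : Exceptional y x
      yx = x≢y ∘ sym , λ yx≡dy → xy≢c (trans (colSym f x y) (trans yx≡dy (others-c y y≢D)))
      partner-of-D : ∀ {u v} → u ≢ D → v ≢ D → Exceptional u v → u ≡ partner D
      partner-of-D {u} {v} u≢D v≢D uv with exceptional? D u
      ... | yes Du = exceptional⇒partner Du
      ... | no ¬Du = ⊥-elim (v≢D (exceptional-unique uv (exceptional-towards u≢D ¬Du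
                       (λ du≡dD → D-differs (trans (sym du≡dD) (others-c u u≢D))))))

-- Zero-sum copies

module ZeroSum {n m} (T : Graph n) (f : Colouring m) (3∣edges : 3 ∣ edgeCount T) where

  colourSum : (Fin n → Fin m) → ℕ
  colourSum φ = edgeSum T (λ i j → toℕ (col f (φ i) (φ j)))

  zeroSumCopy : ∀ {φ} → Injective _≡_ _≡_ φ → 3 ∣ colourSum φ → ZeroSumCopy T f
  zeroSumCopy {φ} φ-injective 3∣sum = φ , φ-injective ,
    n∣m⇒m%n≡0 _ 3 (subst (3 ∣_) (sym (Σfin-edgeSum T (λ i j → toℕ (col f (φ i) (φ j))))) 3∣sum)

  monochromatic-copy : ∀ {φ c} → Injective _≡_ _≡_ φ →
                       (∀ {i j} → adj T i j ≡ true → col f (φ i) (φ j) ≡ c) → ZeroSumCopy T f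
  monochromatic-copy {φ} {c} φ-injective mono =
    zeroSumCopy φ-injective (subst (3 ∣_) (sym sum≡) (∣n⇒∣m*n (toℕ c) 3∣edges))
    where
    sum≡ : colourSum φ ≡ toℕ c * edgeCount T
    sum≡ = begin
      colourSum φ                          ≡⟨ edgeSum-cong T (λ _ _ ij → trans (cong toℕ (mono ij))
                                                                          (sym (*-identityʳ (toℕ c)))) ⟩
      edgeSum T (λ _ _ → toℕ c * 1)        ≡⟨ edgeSum-* T (toℕ c) (λ _ _ → 1) ⟩
      toℕ c * edgeSum T (λ _ _ → 1)        ≡⟨ cong (toℕ c *_) (sym (Σfin-edgeSum T (λ _ _ → 1))) ⟩
      toℕ c * edgeCount T                  ∎
      where open ≡-Reasoning

  -- The colour sum is c (|E| - deg t) + a deg t, stated here without truncated subtraction.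
  two-colour-balance : ∀ {φ t a c} →
                       (∀ {j} → adj T t j ≡ true → col f (φ t) (φ j) ≡ a) →
                       (∀ {i j} → adj T i j ≡ true → i ≢ t → j ≢ t → col f (φ i) (φ j) ≡ c) →
                       colourSum φ + toℕ c * degree T t ≡ toℕ c * edgeCount T + toℕ a * degree T t
  two-colour-balance {φ} {t} {a} {c} at-t off-t = begin
      colourSum φ + toℕ c * degree T t
        ≡⟨ cong (λ x → colourSum φ + toℕ c * x) (sym (edgeSum-incident T t)) ⟩
      edgeSum T w + toℕ c * edgeSum T incident
        ≡⟨ cong (edgeSum T w +_) (sym (edgeSum-* T (toℕ c) incident)) ⟩
      edgeSum T w + edgeSum T (λ i j → toℕ c * incident i j)
        ≡⟨ sym (edgeSum-distrib-+ T w _) ⟩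
      edgeSum T (λ i j → w i j + toℕ c * incident i j)
        ≡⟨ edgeSum-cong T pointwise ⟩
      edgeSum T (λ i j → toℕ c * 1 + toℕ a * incident i j)
        ≡⟨ edgeSum-distrib-+ T (λ _ _ → toℕ c * 1) _ ⟩
      edgeSum T (λ _ _ → toℕ c * 1) + edgeSum T (λ i j → toℕ a * incident i j)
        ≡⟨ cong₂ _+_ (edgeSum-* T (toℕ c) (λ _ _ → 1)) (edgeSum-* T (toℕ a) incident) ⟩
      toℕ c * edgeSum T (λ _ _ → 1) + toℕ a * edgeSum T incident
        ≡⟨ cong₂ (λ x y → toℕ c * x + toℕ a * y) (sym (Σfin-edgeSum T (λ _ _ → 1)))
                                                  (edgeSum-incident T t) ⟩
      toℕ c * edgeCount T + toℕ a * degree T t ∎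
    where
    open ≡-Reasoning
    incident : Fin n → Fin n → ℕ
    incident i j = 𝟙 (does (i ≟ᶠ t)) + 𝟙 (does (j ≟ᶠ t))
    w : Fin n → Fin n → ℕ
    w i j = toℕ (col f (φ i) (φ j))
    coloured-a : ∀ {i j} → w i j ≡ toℕ a → w i j + toℕ c * 1 ≡ toℕ c * 1 + toℕ a * 1
    coloured-a {i} {j} wij≡a = trans (+-comm (w i j) _) (cong (toℕ c * 1 +_) (trans wij≡a (sym (*-identityʳ _))))
    pointwise : ∀ i j → adj T i j ≡ true → w i j + toℕ c * incident i j ≡ toℕ c * 1 + toℕ a * incident i j
    pointwise i j ij with i ≟ᶠ t | j ≟ᶠ t
    ... | yes refl | yes refl = ⊥-elim (adj⇒≢ T ij refl)
    ... | yes refl | no _     = coloured-a (cong toℕ (at-t ij))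
    ... | no _     | yes refl = coloured-a (cong toℕ (trans (colSym f (φ i) (φ t)) (at-t (trans (adj-sym T t i) ij))))
    ... | no i≢t   | no j≢t   = begin
      w i j + toℕ c * 0     ≡⟨ cong (w i j +_) (*-zeroʳ (toℕ c)) ⟩
      w i j + 0             ≡⟨ +-identityʳ (w i j) ⟩
      w i j                 ≡⟨ cong toℕ (off-t ij i≢t j≢t) ⟩
      toℕ c                 ≡⟨ sym (*-identityʳ (toℕ c)) ⟩
      toℕ c * 1             ≡⟨ sym (+-identityʳ (toℕ c * 1)) ⟩
      toℕ c * 1 + 0         ≡⟨ cong (toℕ c * 1 +_) (sym (*-zeroʳ (toℕ a))) ⟩
      toℕ c * 1 + toℕ a * 0 ∎

  two-colour-copy : ∀ {φ t a c} → 3 ∣ degree T t → Injective _≡_ _≡_ φ →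
                    (∀ {j} → adj T t j ≡ true → col f (φ t) (φ j) ≡ a) →
                    (∀ {i j} → adj T i j ≡ true → i ≢ t → j ≢ t → col f (φ i) (φ j) ≡ c) → ZeroSumCopy T f
  two-colour-copy {φ} {t} {a} {c} 3∣deg φ-injective at-t off-t =
    zeroSumCopy φ-injective (∣m+n∣m⇒∣n 3∣c*deg+sum (∣n⇒∣m*n (toℕ c) 3∣deg))
    where
    3∣c*deg+sum : 3 ∣ toℕ c * degree T t + colourSum φ
    3∣c*deg+sum = subst (3 ∣_) (trans (sym (two-colour-balance at-t off-t)) (+-comm (colourSum φ) _))
                        (∣m∣n⇒∣m+n (∣n⇒∣m*n (toℕ c) 3∣edges) (∣n⇒∣m*n (toℕ a) 3∣deg))

module NonStarTreeCopies {n} (T : Graph n) (tree : IsTree T) (non-star : ¬ Isomorphic T (Star-graph n))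
                         (3∣edges : 3 ∣ edgeCount T) where

  module _ {m} (f : Colouring m) (restrictive : Restrictive f) where
    open RestrictiveColouring f restrictive
    open ZeroSum T f 3∣edges

    copy-if-uniform : n ≤ m → ∀ {c} → (∀ w → dominant w ≡ c) → ZeroSumCopy T f
    copy-if-uniform n≤m {c} all-c =
      from-embedding (non-star-tree-avoids-matching T tree non-star n≤m partner partner-involutive)
      where
      open Uniform all-c
      from-embedding : EmbeddingAvoiding T partner → ZeroSumCopy T f
      from-embedding (φ , φ-injective , avoids-partner) = monochromatic-copy {φ = φ} {c = c} φ-injective
        λ ij → colour-off-partner (adj⇒≢ T ij ∘ φ-injective) (avoids-partner ij)

    zero-sum-copy : n ≤ m → 7 ≤ m →
                    (∀ {c D} → (∀ w → w ≢ D → dominant w ≡ c) → dominant D ≢ c → ZeroSumCopy T f) →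
                    ZeroSumCopy T f
    zero-sum-copy n≤m 7≤m copy-if-one-off with dominant-constant-off-one-point 7≤m
    ... | c , D , others-c with dominant D ≟ᶠ c
    ...   | no  D-differs = copy-if-one-off others-c D-differs
    ...   | yes D-c       = copy-if-uniform n≤m all-c
      where
      all-c : ∀ w → dominant w ≡ c
      all-c w with w ≟ᶠ D
      ... | yes refl = D-c
      ... | no  w≢D  = others-c w w≢D

  module _ (f : Colouring (suc n)) (restrictive : Restrictive f) where
    open RestrictiveColouring f restrictive
    open ZeroSum T f 3∣edges

    copy-avoiding-D : ∀ {c D} → (∀ w → w ≢ D → dominant w ≡ c) → dominant D ≢ c → ZeroSumCopy T f
    copy-avoiding-D {c} {D} others-c D-differs =
      monochromatic-copy (punchIn-injective D _ _) λ {i} {j} ij →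
        colour-off-D (punchInᵢ≢i D i) (punchInᵢ≢i D j) (adj⇒≢ T ij ∘ punchIn-injective D i j)
      where open OneOff others-c D-differs

  module _ (f : Colouring n) (restrictive : Restrictive f) {t} (3∣deg : 3 ∣ degree T t) where
    open RestrictiveColouring f restrictive
    open ZeroSum T f 3∣edges

    copy-centred-at-D : ∀ {c D} → (∀ w → w ≢ D → dominant w ≡ c) → dominant D ≢ c → ZeroSumCopy T f
    copy-centred-at-D {c} {D} others-c D-differs =
      two-colour-copy 3∣deg (permutation-injective π) at-t off-t
      where
      open OneOff others-c D-differs
      centring : ∃ λ (π : Permutation n n) →
                   π ⟨$⟩ʳ t ≡ D × (∀ {j} → adj T t j ≡ true → ¬ Exceptional D (π ⟨$⟩ʳ j))
      centring with any? (exceptional? D)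
      ... | no  none    = transpose t D , transpose-applyˡ t D , λ _ exc → none (_ , exc)
      ... | yes (w , Dw) with RootedTree.∃-non-neighbour T tree t non-star
      ...   | s , s≢t , t≁s with ∃-permutation-sending s≢t (proj₁ Dw ∘ sym)
      ...     | π , πt , πs = π , πt , λ {j} tj Dπj →
                  not-¬ t≁s (subst (λ x → adj T t x ≡ true)
                                   (permutation-injective π {j} {s} (trans (exceptional-unique Dπj Dw) (sym πs))) tj)
      π = proj₁ centring
      πt≡D = proj₁ (proj₂ centring)
      πi≢D : ∀ {i} → i ≢ t → π ⟨$⟩ʳ i ≢ D
      πi≢D i≢t πi≡D = i≢t (permutation-injective π (trans πi≡D (sym πt≡D)))
      at-t : ∀ {j} → adj T t j ≡ true → col f (π ⟨$⟩ʳ t) (π ⟨$⟩ʳ j) ≡ dominant D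
      at-t {j} tj = trans (cong (λ x → col f x (π ⟨$⟩ʳ j)) πt≡D)
                          (unexceptional-colour (πi≢D {j} (adj⇒≢ T tj ∘ sym) ∘ sym) (proj₂ (proj₂ centring) tj))
      off-t : ∀ {i j} → adj T i j ≡ true → i ≢ t → j ≢ t → col f (π ⟨$⟩ʳ i) (π ⟨$⟩ʳ j) ≡ c
      off-t ij i≢t j≢t = colour-off-D (πi≢D i≢t) (πi≢D j≢t) (adj⇒≢ T ij ∘ permutation-injective π)

proposition16 : (n : ℕ) → 6 ≤ n → n % 3 ≡ 1 →
    (T : Graph n) → IsTree T → ¬ Isomorphic T (Star-graph n) →
    (HasDegree0mod3 T →
       (f : Colouring n) → Restrictive f → ZeroSumCopy T f)
    × (¬ HasDegree0mod3 T →
       (f : Colouring (suc n)) → Restrictive f → ZeroSumCopy T f)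
proposition16 n 6≤n n%3≡1 T tree non-star =
    (λ (t , deg%3≡0) f restrictive →
       zero-sum-copy f restrictive ≤-refl 7≤n (copy-centred-at-D f restrictive (m%n≡0⇒n∣m _ 3 deg%3≡0)))
  , (λ _ f restrictive →
       zero-sum-copy f restrictive (n≤1+n n) (m≤n⇒m≤1+n 7≤n) (copy-avoiding-D f restrictive))
  where
  7≤n : 7 ≤ n
  7≤n = ≤∧≢⇒< 6≤n λ { refl → 0≢1+n n%3≡1 }
  3∣edges : 3 ∣ edgeCount T
  3∣edges = divides (n / 3)
    (suc-injective (trans (proj₂ tree) (trans (m≡m%n+[m/n]*n n 3) (cong (_+ (n / 3) * 3) n%3≡1))))
  open NonStarTreeCopies T tree non-star 3∣edges
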